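{- Let $G=(V,E)$ be a graph, let $k\ge 2$, and let $\{S_1,\dots,S_k\}$ be a partition of $V$ into $k$ parts. For $i\in[k]$ let $\mathbf{s}^{(i)}\in\mathbb{R}^n$ be defined by $s^{(i)}_j=-k+1$ if $v_j\in S_i$ and $s^{(i)}_j=1$ otherwise. Then $(\mu,\mathbf{s}^{(i)})$ is an eigenpair of the Laplacian $L=D-A$ of $G$ for every $i\in[k]$ if and only if, for all $i\neq j$ in $[k]$, the bipartite graph with vertex set $S_i\cup S_j$ and edge set $E(S_i,S_j)$ is $\frac{\mu}{k}$-regular (i.e. every vertex of $S_i$ has exactly $\mu/k$ neighbours in $S_j$ and every vertex of $S_j$ has exactly $\mu/k$ neighbours in $S_i$).
   Context: Graphs are finite, simple and undirected with vertex set $V=\{v_1,\dots,v_n\}$; $A$ is the adjacency matrix and $D$ the diagonal degree matrix. $E(X,Y)$ denotes the set of edges with one endpoint in $X$ and the other in $Y$.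
   Formalization: The eigenvalue μ ranges over the rationals rather than the real numbers. -}

module Defs where

open import Data.Nat using (ℕ; zero; suc)
open import Data.Fin using (Fin; zero; suc)
open import Data.Bool using (Bool; true; false)
open import Data.Integer using (+_; -[1+_])
open import Data.Rational using (ℚ; _/_; _+_; _*_; _-_; 0ℚ; 1ℚ)
open import Data.Product using (Σ; _×_)
open import Relation.Binary.PropositionalEquality using (_≡_)
open import Relation.Nullary using (¬_)
open import Function.Definitions using (Surjective)

record Graph (n : ℕ) : Set where
  field
    adj   : Fin n → Fin n → Bool
    sym   : ∀ u v → adj u v ≡ adj v u
    irrefl : ∀ v → adj v v ≡ false
open Graph public

Σℚ : (n : ℕ) → (Fin n → ℚ) → ℚ
Σℚ zero    f = 0ℚ
Σℚ (suc n) f = f zero + Σℚ n (λ i → f (suc i))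

Σℕ : (n : ℕ) → (Fin n → ℕ) → ℕ
Σℕ zero    f = 0
Σℕ (suc n) f = f zero Data.Nat.+ Σℕ n (λ i → f (suc i))

bℚ : Bool → ℚ
bℚ true  = 1ℚ
bℚ false = 0ℚ

bℕ : Bool → ℕ
bℕ true  = 1
bℕ false = 0

ℕtoℚ : ℕ → ℚ
ℕtoℚ m = + m / 1

Matrix : ℕ → Set
Matrix n = Fin n → Fin n → ℚ

Vector : ℕ → Set
Vector n = Fin n → ℚ

adjMatrix : ∀ {n} → Graph n → Matrix n
adjMatrix G u v = bℚ (adj G u v)

degMatrix : ∀ {n} → Graph n → Matrix n
degMatrix {n} G u v with u Data.Fin.≟ v
... | Relation.Nullary.yes _ = Σℚ n (λ w → adjMatrix G u w)
... | Relation.Nullary.no  _ = 0ℚ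

laplacian : ∀ {n} → Graph n → Matrix n
laplacian G u v = degMatrix G u v - adjMatrix G u v

_·_ : ∀ {n} → Matrix n → Vector n → Vector n
_·_ {n} M x u = Σℚ n (λ v → M u v * x v)

_•_ : ∀ {n} → ℚ → Vector n → Vector n
(c • x) u = c * x u

IsEigenpair : ∀ {n} → Matrix n → ℚ → Vector n → Set
IsEigenpair {n} M μ x = (¬ (∀ v → x v ≡ 0ℚ)) × (∀ v → (M · x) v ≡ (μ • x) v)

-- A partition {S_1..S_k} of V into k (nonempty) parts, given by the part map.
-- v ∈ S_i  iff  part v ≡ i.
record Partition (n k : ℕ) : Set where
  field
    part : Fin n → Fin k
    nonempty : Surjective _≡_ _≡_ part
open Partition public

sVec : ∀ {n k} → Partition n k → Fin k → Vector n
sVec {n} {k} P i v with part P v Data.Fin.≟ i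
... | Relation.Nullary.yes _ = 1ℚ - ℕtoℚ k
... | Relation.Nullary.no  _ = 1ℚ

inPart : ∀ {n k} → Partition n k → Fin k → Fin n → Bool
inPart P j u with part P u Data.Fin.≟ j
... | Relation.Nullary.yes _ = true
... | Relation.Nullary.no  _ = false

-- number of neighbours of v in S_j, i.e. degree of v in the graph (S_i ∪ S_j, E(S_i,S_j))
-- when v ∈ S_i, i ≠ j
degInto : ∀ {n k} → Graph n → Partition n k → Fin n → Fin k → ℕ
degInto {n} G P v j = Σℕ n (λ u → bℕ (adj G v u Data.Bool.∧ inPart P j u))

-- q / k for a natural number k (convention: q / 0 = 0; only used with k ≥ 2)
_/ℕ_ : ℚ → ℕ → ℚ
q /ℕ zero  = 0ℚ
q /ℕ suc m = q * (+ 1 / suc m)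

BipartiteRegular : ∀ {n k} → Graph n → Partition n k → Fin k → Fin k → ℚ → Set
BipartiteRegular {n} G P i j r =
  (∀ v → part P v ≡ i → ℕtoℚ (degInto G P v j) ≡ r) ×
  (∀ v → part P v ≡ j → ℕtoℚ (degInto G P v i) ≡ r)

-- Write s⁽ⁱ⁾ = 𝟏 − k·χᵢ with χᵢ the indicator of Sᵢ, and let dⱼ(v) be the number of neighbours of
-- v in Sⱼ. Then (L s⁽ⁱ⁾)(v) = k·(dᵢ(v) − χᵢ(v)·deg v). For v ∉ Sᵢ the eigen-equation at v says
-- k·dᵢ(v) = μ, which is exactly the regularity condition. For v ∈ Sᵢ it says
-- k·(dᵢ(v) − deg v) = (1 − k)·μ, and since deg v = Σⱼ dⱼ(v) this follows once dⱼ(v) = μ/k for the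
-- k − 1 indices j ≠ i. The vector s⁽ⁱ⁾ is nonzero because it equals 1 on any other (nonempty) part.
module Submission where

open import Defs hiding (sym)
open import Algebra.Bundles using (CommutativeRing)
open import Data.Bool using (true; false; _∧_)
open import Data.Fin using (Fin; zero; suc; punchIn; _≟_)
open import Data.Fin.Properties using (punchInᵢ≢i)
open import Data.Integer as ℤ using (+_)
import Data.Integer.Properties as ℤ
open import Data.Nat as ℕ using (ℕ; zero; suc; _≤_; s≤s; z≤n)
open import Data.Nat.Coprimality as Coprime using (1-coprimeTo)
open import Data.Product using (_×_; _,_; proj₁; proj₂)
open import Data.Rational using (ℚ; mkℚ; 0ℚ; 1ℚ; _+_; _*_; _-_; -_; _/_)
open import Data.Rational.Properties
  using (+-*-commutativeRing; 1≢0; +-identityʳ; *-identityʳ; *-zeroˡ; *-inverseʳ; normalize-coprime)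
open import Data.Rational.Solver using (module +-*-Solver)
open import Function using (_∘_)
open import Relation.Binary.PropositionalEquality
open import Relation.Nullary using (¬_; Dec; yes; no; contradiction)

open import Algebra.Properties.Semiring.Sum (CommutativeRing.semiring +-*-commutativeRing)
  using (sum; sum-syntax; sum-remove; sum-cong-≗; sum-replicate-zero; ∑-distrib-+; ∑-comm; *-distribˡ-sum)
open +-*-Solver

Σℚ≡sum : ∀ n (f : Fin n → ℚ) → Σℚ n f ≡ sum f
Σℚ≡sum zero    f = refl
Σℚ≡sum (suc n) f = cong (λ s → f zero + s) (Σℚ≡sum n (f ∘ suc))

sum-single : ∀ {n} (f : Fin n → ℚ) i → (∀ j → j ≢ i → f j ≡ 0ℚ) → sum f ≡ f i
sum-single {suc n} f i vanish = begin
  sum f                      ≡⟨ sum-remove {i = i} f ⟩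
  f i + sum (f ∘ punchIn i)  ≡⟨ cong (λ s → f i + s) (sum-cong-≗ {n} (λ j → vanish _ (punchInᵢ≢i i j))) ⟩
  f i + sum {n} (λ _ → 0ℚ)   ≡⟨ cong (λ s → f i + s) (sum-replicate-zero n) ⟩
  f i + 0ℚ                   ≡⟨ +-identityʳ (f i) ⟩
  f i                        ∎
  where open ≡-Reasoning

sum-distrib-sub : ∀ {n} (f g : Fin n → ℚ) → ∑[ i < n ] (f i - g i) ≡ sum f - sum g
sum-distrib-sub {n} f g = begin
  ∑[ i < n ] (f i - g i)           ≡⟨ sum-cong-≗ {n} (λ i → x-y≡x+-1*y (f i) (g i)) ⟩
  ∑[ i < n ] (f i + - 1ℚ * g i)    ≡⟨ ∑-distrib-+ f (λ i → - 1ℚ * g i) ⟩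
  sum f + ∑[ i < n ] (- 1ℚ * g i)  ≡⟨ cong (λ s → sum f + s) (*-distribˡ-sum (- 1ℚ) g) ⟨
  sum f + - 1ℚ * sum g             ≡⟨ x-y≡x+-1*y (sum f) (sum g) ⟨
  sum f - sum g                    ∎
  where
  open ≡-Reasoning
  x-y≡x+-1*y : ∀ x y → x - y ≡ x + - 1ℚ * y
  x-y≡x+-1*y = solve 2 (λ x y → x :- y := x :+ (:- con 1ℚ) :* y) refl

ℕtoℚ≡mkℚ : ∀ m → ℕtoℚ m ≡ mkℚ (+ m) 0 (Coprime.sym (1-coprimeTo m))
ℕtoℚ≡mkℚ m = normalize-coprime (Coprime.sym (1-coprimeTo m))

ℕtoℚ-+ : ∀ m n → ℕtoℚ (m ℕ.+ n) ≡ ℕtoℚ m + ℕtoℚ n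
-- Once both summands are in normal form mkℚ (+ _) 0 _, rational addition computes to the middle term.
ℕtoℚ-+ m n = begin
  + (m ℕ.+ n) / 1                    ≡⟨ cong (_/ 1) (cong₂ ℤ._+_ (ℤ.*-identityʳ (+ m)) (ℤ.*-identityʳ (+ n))) ⟨
  (+ m ℤ.* + 1 ℤ.+ + n ℤ.* + 1) / 1  ≡⟨ cong₂ _+_ (ℕtoℚ≡mkℚ m) (ℕtoℚ≡mkℚ n) ⟨
  ℕtoℚ m + ℕtoℚ n                    ∎
  where open ≡-Reasoning

ℕtoℚ-Σℕ : ∀ n (f : Fin n → ℕ) → ℕtoℚ (Σℕ n f) ≡ ∑[ i < n ] ℕtoℚ (f i)
ℕtoℚ-Σℕ zero    f = refl
ℕtoℚ-Σℕ (suc n) f = trans (ℕtoℚ-+ (f zero) _) (cong (λ s → ℕtoℚ (f zero) + s) (ℕtoℚ-Σℕ n (f ∘ suc)))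

sum-const : ∀ n c → ∑[ i < n ] c ≡ ℕtoℚ n * c
sum-const zero    c = sym (*-zeroˡ c)
sum-const (suc n) c = begin
  c + ∑[ i < n ] c   ≡⟨ cong (λ s → c + s) (sum-const n c) ⟩
  c + ℕtoℚ n * c     ≡⟨ solve 2 (λ c N → c :+ N :* c := (con 1ℚ :+ N) :* c) refl c (ℕtoℚ n) ⟩
  (1ℚ + ℕtoℚ n) * c  ≡⟨ cong (_* c) (ℕtoℚ-+ 1 n) ⟨
  ℕtoℚ (suc n) * c   ∎
  where open ≡-Reasoning

sum-allBut : ∀ {n} (f : Fin n → ℚ) i r → (∀ j → j ≢ i → f j ≡ r) → sum f ≡ ℕtoℚ n * r + (f i - r)
sum-allBut {n} f i r others = begin
  sum f                                ≡⟨ sum-cong-≗ {n} (λ j → solve 2 (λ x r → x := r :+ (x :- r)) refl (f j) r) ⟩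
  ∑[ j < n ] (r + (f j - r))           ≡⟨ ∑-distrib-+ (λ _ → r) (λ j → f j - r) ⟩
  ∑[ j < n ] r + ∑[ j < n ] (f j - r)  ≡⟨ cong₂ _+_ (sum-const n r) (sum-single (λ j → f j - r) i deviation) ⟩
  ℕtoℚ n * r + (f i - r)               ∎
  where
  open ≡-Reasoning
  deviation : ∀ j → j ≢ i → f j - r ≡ 0ℚ
  deviation j j≢i rewrite others j j≢i = solve 1 (λ r → r :- r := con 0ℚ) refl r

ℕtoℚ*-/ℕ : ∀ m q → ℕtoℚ (suc m) * (q /ℕ suc m) ≡ q
ℕtoℚ*-/ℕ m q = begin
  K * (q * (+ 1 / suc m))
    ≡⟨ solve 3 (λ K q c → K :* (q :* c) := q :* (K :* c)) refl K q (+ 1 / suc m) ⟩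
  q * (K * (+ 1 / suc m))
    ≡⟨ cong₂ (λ K c → q * (K * c)) (ℕtoℚ≡mkℚ (suc m)) (normalize-coprime (1-coprimeTo (suc m))) ⟩
  q * (K′ * K′⁻¹)
    ≡⟨ cong (q *_) (*-inverseʳ K′) ⟩
  q * 1ℚ
    ≡⟨ *-identityʳ q ⟩
  q
    ∎
  where
  open ≡-Reasoning
  K = ℕtoℚ (suc m)
  K′ = mkℚ (+ suc m) 0 (Coprime.sym (1-coprimeTo (suc m)))
  K′⁻¹ = mkℚ (+ 1) m (1-coprimeTo (suc m))

ℕtoℚ*≡⇒≡/ℕ : ∀ m {q x} → ℕtoℚ (suc m) * x ≡ q → x ≡ q /ℕ suc m
ℕtoℚ*≡⇒≡/ℕ m {q} {x} Kx≡q = begin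
  x
    ≡⟨ ℕtoℚ*-/ℕ m x ⟨
  ℕtoℚ (suc m) * (x /ℕ suc m)
    ≡⟨ solve 3 (λ K x c → K :* (x :* c) := (K :* x) :* c) refl (ℕtoℚ (suc m)) x (+ 1 / suc m) ⟩
  (ℕtoℚ (suc m) * x) /ℕ suc m
    ≡⟨ cong (_/ℕ suc m) Kx≡q ⟩
  q /ℕ suc m
    ∎
  where open ≡-Reasoning

module _ {n : ℕ} (G : Graph n) where

  degree : Fin n → ℚ
  degree v = sum (adjMatrix G v)

  degMatrix-diagonal : ∀ v → degMatrix G v v ≡ degree v
  degMatrix-diagonal v with v ≟ v
  ... | yes _  = Σℚ≡sum n (adjMatrix G v)
  ... | no v≢v = contradiction refl v≢v

  degMatrix-offDiagonal : ∀ {v w} → w ≢ v → degMatrix G v w ≡ 0ℚ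
  degMatrix-offDiagonal {v} {w} w≢v with v ≟ w
  ... | yes v≡w = contradiction (sym v≡w) w≢v
  ... | no _    = refl

  laplacian-apply : ∀ x v → (laplacian G · x) v ≡ degree v * x v - ∑[ u < n ] (adjMatrix G v u * x u)
  laplacian-apply x v = begin
    Σℚ n (λ u → (degMatrix G v u - adjMatrix G v u) * x u)
      ≡⟨ Σℚ≡sum n _ ⟩
    ∑[ u < n ] ((degMatrix G v u - adjMatrix G v u) * x u)
      ≡⟨ sum-cong-≗ {n} (λ u → solve 3 (λ d a y → (d :- a) :* y := d :* y :- a :* y) refl
                                        (degMatrix G v u) (adjMatrix G v u) (x u)) ⟩
    ∑[ u < n ] (degMatrix G v u * x u - adjMatrix G v u * x u)
      ≡⟨ sum-distrib-sub (λ u → degMatrix G v u * x u) (λ u → adjMatrix G v u * x u) ⟩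
    ∑[ u < n ] (degMatrix G v u * x u) - Ax
      ≡⟨ cong (_- Ax) (sum-single _ v offDiagonal) ⟩
    degMatrix G v v * x v - Ax
      ≡⟨ cong (λ d → d * x v - Ax) (degMatrix-diagonal v) ⟩
    degree v * x v - Ax
      ∎
    where
    open ≡-Reasoning
    Ax = ∑[ u < n ] (adjMatrix G v u * x u)
    offDiagonal : ∀ w → w ≢ v → degMatrix G v w * x w ≡ 0ℚ
    offDiagonal w w≢v rewrite degMatrix-offDiagonal w≢v = *-zeroˡ (x w)

module _ {n k : ℕ} (G : Graph n) (P : Partition n k) where

  K : ℚ
  K = ℕtoℚ k

  indicator : Fin k → Fin n → ℚ
  indicator j u = bℚ (inPart P j u)

  indicator-member : ∀ {j u} → part P u ≡ j → indicator j u ≡ 1ℚ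
  indicator-member {j} {u} u∈j with part P u ≟ j
  ... | yes _   = refl
  ... | no u∉j = contradiction u∈j u∉j

  indicator-nonmember : ∀ {j u} → part P u ≢ j → indicator j u ≡ 0ℚ
  indicator-nonmember {j} {u} u∉j with part P u ≟ j
  ... | yes u∈j = contradiction u∈j u∉j
  ... | no _    = refl

  sum-indicator : ∀ u → ∑[ j < k ] indicator j u ≡ 1ℚ
  sum-indicator u =
    trans (sum-single (λ j → indicator j u) (part P u) (λ j j≢ → indicator-nonmember (j≢ ∘ sym)))
          (indicator-member refl)

  neighboursIn : Fin n → Fin k → ℚ
  neighboursIn v j = ℕtoℚ (degInto G P v j)

  neighboursIn≡∑ : ∀ v j → neighboursIn v j ≡ ∑[ u < n ] (adjMatrix G v u * indicator j u)
  neighboursIn≡∑ v j = trans (ℕtoℚ-Σℕ n _) (sum-cong-≗ {n} (λ u → bℕ-∧ (adj G v u) (inPart P j u)))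
    where
    bℕ-∧ : ∀ x y → ℕtoℚ (bℕ (x ∧ y)) ≡ bℚ x * bℚ y
    bℕ-∧ true  true  = refl
    bℕ-∧ true  false = refl
    bℕ-∧ false y     = sym (*-zeroˡ (bℚ y))

  degree≡∑neighboursIn : ∀ v → degree G v ≡ ∑[ j < k ] neighboursIn v j
  degree≡∑neighboursIn v = begin
    ∑[ u < n ] adjMatrix G v u
      ≡⟨ sum-cong-≗ {n} (λ u → *-identityʳ (adjMatrix G v u)) ⟨
    ∑[ u < n ] (adjMatrix G v u * 1ℚ)
      ≡⟨ sum-cong-≗ {n} (λ u → cong (adjMatrix G v u *_) (sum-indicator u)) ⟨
    ∑[ u < n ] (adjMatrix G v u * ∑[ j < k ] indicator j u)
      ≡⟨ sum-cong-≗ {n} (λ u → *-distribˡ-sum (adjMatrix G v u) (λ j → indicator j u)) ⟩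
    ∑[ u < n ] ∑[ j < k ] (adjMatrix G v u * indicator j u)
      ≡⟨ ∑-comm (λ u j → adjMatrix G v u * indicator j u) ⟩
    ∑[ j < k ] ∑[ u < n ] (adjMatrix G v u * indicator j u)
      ≡⟨ sum-cong-≗ {k} (λ j → neighboursIn≡∑ v j) ⟨
    ∑[ j < k ] neighboursIn v j
      ∎
    where open ≡-Reasoning

  sVec≡1-K*indicator : ∀ i u → sVec P i u ≡ 1ℚ - K * indicator i u
  sVec≡1-K*indicator i u with part P u ≟ i
  ... | yes _ = cong (λ t → 1ℚ - t) (sym (*-identityʳ K))
  ... | no _  = solve 1 (λ K → con 1ℚ := con 1ℚ :- K :* con 0ℚ) refl K

  sVec-member : ∀ {i u} → part P u ≡ i → sVec P i u ≡ 1ℚ - K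
  sVec-member {i} {u} u∈i with part P u ≟ i
  ... | yes _   = refl
  ... | no u∉i = contradiction u∈i u∉i

  sVec-nonmember : ∀ {i u} → part P u ≢ i → sVec P i u ≡ 1ℚ
  sVec-nonmember {i} {u} u∉i with part P u ≟ i
  ... | yes u∈i = contradiction u∈i u∉i
  ... | no _    = refl

  sVec-nonzero : ∀ {i i′} → i′ ≢ i → ¬ (∀ u → sVec P i u ≡ 0ℚ)
  sVec-nonzero {i} {i′} i′≢i sᵢ≡0 = 1≢0 (trans (sym (sVec-nonmember (i′≢i ∘ trans (sym w∈i′)))) (sᵢ≡0 w))
    where
    w = proj₁ (nonempty P i′)
    w∈i′ : part P w ≡ i′
    w∈i′ = proj₂ (nonempty P i′) refl

  laplacian-sVec : ∀ i v → (laplacian G · sVec P i) v ≡ K * (neighboursIn v i - indicator i v * degree G v)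
  laplacian-sVec i v = begin
    (laplacian G · sVec P i) v
      ≡⟨ laplacian-apply G (sVec P i) v ⟩
    d * sVec P i v - ∑[ u < n ] (adjMatrix G v u * sVec P i u)
      ≡⟨ cong₂ (λ s t → d * s - t) (sVec≡1-K*indicator i v)
               (sum-cong-≗ {n} (λ u → cong (adjMatrix G v u *_) (sVec≡1-K*indicator i u))) ⟩
    d * (1ℚ - K * χᵢ) - ∑[ u < n ] (adjMatrix G v u * (1ℚ - K * indicator i u))
      ≡⟨ cong (λ t → d * (1ℚ - K * χᵢ) - t) (sum-cong-≗ {n} (λ u →
           solve 3 (λ a K χ → a :* (con 1ℚ :- K :* χ) := a :- K :* (a :* χ)) refl (adjMatrix G v u) K (indicator i u))) ⟩
    d * (1ℚ - K * χᵢ) - ∑[ u < n ] (adjMatrix G v u - K * (adjMatrix G v u * indicator i u))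
      ≡⟨ cong (λ t → d * (1ℚ - K * χᵢ) - t)
              (trans (sum-distrib-sub (adjMatrix G v) (λ u → K * (adjMatrix G v u * indicator i u)))
                     (cong (λ t → d - t) (sym (*-distribˡ-sum K (λ u → adjMatrix G v u * indicator i u))))) ⟩
    d * (1ℚ - K * χᵢ) - (d - K * ∑[ u < n ] (adjMatrix G v u * indicator i u))
      ≡⟨ cong (λ N → d * (1ℚ - K * χᵢ) - (d - K * N)) (neighboursIn≡∑ v i) ⟨
    d * (1ℚ - K * χᵢ) - (d - K * neighboursIn v i)
      ≡⟨ solve 4 (λ d K χ N → d :* (con 1ℚ :- K :* χ) :- (d :- K :* N) := K :* (N :- χ :* d)) refl
                 d K χᵢ (neighboursIn v i) ⟩
    K * (neighboursIn v i - χᵢ * d)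
      ∎
    where
    open ≡-Reasoning
    d = degree G v
    χᵢ = indicator i v

  laplacian-sVec-nonmember : ∀ {i v} → part P v ≢ i → (laplacian G · sVec P i) v ≡ K * neighboursIn v i
  laplacian-sVec-nonmember {i} {v} v∉i = begin
    (laplacian G · sVec P i) v         ≡⟨ laplacian-sVec i v ⟩
    K * (Nᵢ - indicator i v * d)       ≡⟨ cong (λ χ → K * (Nᵢ - χ * d)) (indicator-nonmember v∉i) ⟩
    K * (Nᵢ - 0ℚ * d)                  ≡⟨ solve 3 (λ K N d → K :* (N :- con 0ℚ :* d) := K :* N) refl K Nᵢ d ⟩
    K * Nᵢ                             ∎
    where
    open ≡-Reasoning
    Nᵢ = neighboursIn v i
    d = degree G v

  laplacian-sVec-member : ∀ {i v} r → part P v ≡ i → (∀ j → j ≢ i → neighboursIn v j ≡ r) →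
                          (laplacian G · sVec P i) v ≡ K * r * (1ℚ - K)
  laplacian-sVec-member {i} {v} r v∈i regular = begin
    (laplacian G · sVec P i) v             ≡⟨ laplacian-sVec i v ⟩
    K * (Nᵢ - indicator i v * degree G v)  ≡⟨ cong₂ (λ χ d → K * (Nᵢ - χ * d)) (indicator-member v∈i) degree≡ ⟩
    K * (Nᵢ - 1ℚ * (K * r + (Nᵢ - r)))     ≡⟨ solve 3 (λ K N r → K :* (N :- con 1ℚ :* (K :* r :+ (N :- r)))
                                                             := K :* r :* (con 1ℚ :- K)) refl K Nᵢ r ⟩
    K * r * (1ℚ - K)                       ∎
    where
    open ≡-Reasoning
    Nᵢ = neighboursIn v i
    degree≡ : degree G v ≡ K * r + (Nᵢ - r)
    degree≡ = trans (degree≡∑neighboursIn v) (sum-allBut (neighboursIn v) i r regular)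

  eigenEquation-nonmember⇒ : ∀ {μ i v} → part P v ≢ i →
                             (laplacian G · sVec P i) v ≡ (μ • sVec P i) v → K * neighboursIn v i ≡ μ
  eigenEquation-nonmember⇒ {μ} {i} {v} v∉i eigen = begin
    K * neighboursIn v i        ≡⟨ laplacian-sVec-nonmember v∉i ⟨
    (laplacian G · sVec P i) v  ≡⟨ eigen ⟩
    μ * sVec P i v              ≡⟨ cong (μ *_) (sVec-nonmember v∉i) ⟩
    μ * 1ℚ                      ≡⟨ *-identityʳ μ ⟩
    μ                           ∎
    where open ≡-Reasoning

  eigenEquation-nonmember⇐ : ∀ {μ i v} r → K * r ≡ μ → part P v ≢ i → neighboursIn v i ≡ r →
                             (laplacian G · sVec P i) v ≡ (μ • sVec P i) v
  eigenEquation-nonmember⇐ {μ} {i} {v} r Kr≡μ v∉i regular = begin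
    (laplacian G · sVec P i) v  ≡⟨ laplacian-sVec-nonmember v∉i ⟩
    K * neighboursIn v i        ≡⟨ cong (K *_) regular ⟩
    K * r                       ≡⟨ Kr≡μ ⟩
    μ                           ≡⟨ *-identityʳ μ ⟨
    μ * 1ℚ                      ≡⟨ cong (μ *_) (sVec-nonmember v∉i) ⟨
    μ * sVec P i v              ∎
    where open ≡-Reasoning

  eigenEquation-member : ∀ {μ i v} r → K * r ≡ μ → part P v ≡ i →
                         (∀ j → j ≢ i → neighboursIn v j ≡ r) →
                         (laplacian G · sVec P i) v ≡ (μ • sVec P i) v
  eigenEquation-member {μ} {i} {v} r Kr≡μ v∈i regular = begin
    (laplacian G · sVec P i) v  ≡⟨ laplacian-sVec-member r v∈i regular ⟩
    K * r * (1ℚ - K)            ≡⟨ cong (_* (1ℚ - K)) Kr≡μ ⟩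
    μ * (1ℚ - K)                ≡⟨ cong (μ *_) (sVec-member v∈i) ⟨
    μ * sVec P i v              ∎
    where open ≡-Reasoning

corollary4p4 : (n k : ℕ) → 2 ≤ k → (G : Graph n) → (P : Partition n k) → (μ : ℚ) →
    ((∀ (i : Fin k) → IsEigenpair (laplacian G) μ (sVec P i)) →
      (∀ (i j : Fin k) → i ≢ j → BipartiteRegular G P i j (μ /ℕ k)))
    × ((∀ (i j : Fin k) → i ≢ j → BipartiteRegular G P i j (μ /ℕ k)) →
      (∀ (i : Fin k) → IsEigenpair (laplacian G) μ (sVec P i)))
corollary4p4 n (suc (suc m)) (s≤s (s≤s z≤n)) G P μ = eigenpairs⇒regular , regular⇒eigenpairs
  where
  r = μ /ℕ suc (suc m)

  regularAt : ∀ {v j} → part P v ≢ j → (laplacian G · sVec P j) v ≡ (μ • sVec P j) v →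
              neighboursIn G P v j ≡ r
  regularAt v∉j eigen = ℕtoℚ*≡⇒≡/ℕ (suc m) (eigenEquation-nonmember⇒ G P {μ} v∉j eigen)

  eigenpairs⇒regular : (∀ i → IsEigenpair (laplacian G) μ (sVec P i)) →
                       ∀ i j → i ≢ j → BipartiteRegular G P i j r
  eigenpairs⇒regular eigen i j i≢j =
      (λ v v∈i → regularAt (i≢j ∘ trans (sym v∈i)) (proj₂ (eigen j) v))
    , (λ v v∈j → regularAt (i≢j ∘ sym ∘ trans (sym v∈j)) (proj₂ (eigen i) v))

  regular⇒eigenpairs : (∀ i j → i ≢ j → BipartiteRegular G P i j r) →
                       ∀ i → IsEigenpair (laplacian G) μ (sVec P i)
  regular⇒eigenpairs regular i = sVec-nonzero G P (punchInᵢ≢i i zero) , λ v → eigenEquation v (part P v ≟ i)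
    where
    eigenEquation : ∀ v → Dec (part P v ≡ i) → (laplacian G · sVec P i) v ≡ (μ • sVec P i) v
    eigenEquation v (yes v∈i) =
      eigenEquation-member G P r (ℕtoℚ*-/ℕ (suc m) μ) v∈i (λ j j≢i → proj₁ (regular i j (j≢i ∘ sym)) v v∈i)
    eigenEquation v (no v∉i)  =
      eigenEquation-nonmember⇐ G P r (ℕtoℚ*-/ℕ (suc m) μ) v∉i (proj₁ (regular (part P v) i v∉i) v refl)
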